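{- Let $\Phi$ be a $\mathsf{BST}^{\otimes}$-conjunction involving $n$ distinct set variables. Then $\Phi$ is satisfiable if and only if $\Phi$ is fulfilled by an accessible $\otimes$-graph of size at most $2^{n}-1$.
   Context: Sets are elements of the von Neumann universe of well-founded sets. For sets $s,t$, the unordered Cartesian product is $s\otimes t:=\{\{u,v\} : u\in s,\ v\in t\}$. A $\mathsf{BST}^{\otimes}$-conjunction is a finite conjunction of literals of the forms $x=y\cup z$, $x=y\setminus z$, $x=y\otimes z$, $x\neq y$, where $x,y,z$ are set variables; $\mathrm{Vars}(\Phi)$ denotes its set of variables. A set assignment $M$ maps each variable in $\mathrm{Vars}(\Phi)$ to a well-founded set; $M$ satisfies (is a model of) $\Phi$ if every literal is true when $\cup,\setminus,\otimes,=$ are interpreted as usual on the values $Mx$. $\Phi$ is satisfiable if it has a model. A $\otimes$-graph $\mathcal{G}=(\mathcal{P},\mathcal{N},\mathcal{T})$ consists of a set $\mathcal{P}$ of places, the set of nodes $\mathcal{N}=\mathcal{P}\otimes\mathcal{P}$ (i.e. the nonempty subsets of $\mathcal{P}$ with at most two elements), with $\mathcal{P}\cap\mathcal{N}=\emptyset$, and a target map $\mathcal{T}:\mathcal{N}\to\mathcal{P}(\mathcal{P})$ (power set); $q\in\mathcal{T}(B)$ means there is an edge from node $B$ to place $q$ ($q$ is a target of $B$). Its size is $|\mathcal{P}|$. A place is a source place if it is the target of no node. The set of accessible places is the least set containing all source places and such that whenever all places of a node $B$ are accessible, all places in $\mathcal{T}(B)$ are accessible. $\mathcal{G}$ is accessible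 if all its places are accessible. An accessible $\otimes$-graph $\mathcal{G}=(\mathcal{P},\mathcal{N},\mathcal{T})$ fulfills a $\mathsf{BST}^{\otimes}$-conjunction $\Phi$ if there is a map $\mathfrak{F}:\mathrm{Vars}(\Phi)\to\mathcal{P}(\mathcal{P})$ such that: (a) $\mathfrak{F}(x)=\mathfrak{F}(y)\star\mathfrak{F}(z)$ for every conjunct $x=y\star z$ of $\Phi$ with $\star\in\{\cup,\setminus\}$; (b) $\mathfrak{F}(x)\neq\mathfrak{F}(y)$ for every conjunct $x\neq y$; (c) for every conjunct $x=y\otimes z$: (c1) $\emptyset\neq\mathcal{T}(\{\upsilon,\zeta\})\subseteq\mathfrak{F}(x)$ for all $\upsilon\in\mathfrak{F}(y)$, $\zeta\in\mathfrak{F}(z)$; (c2) $\mathfrak{F}(x)\subseteq\bigcup\mathcal{T}[\mathfrak{F}(y)\otimes\mathfrak{F}(z)]$; (c3) $\bigcup\mathcal{T}[\mathcal{N}\setminus(\mathfrak{F}(y)\otimes\mathfrak{F}(z))]\cap\mathfrak{F}(x)=\emptyset$. Here $\mathcal{T}[X]=\{\mathcal{T}(B):B\in X\}$. -}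

module Defs where

open import Data.Nat using (ℕ; _≤_; _∸_; _^_)
open import Data.Fin using (Fin)
open import Data.Fin.Subset as S using (Subset; Nonempty; _⊆_)
open import Data.Bool using (Bool; true; false)
open import Data.Product using (Σ; ∃; ∃-syntax; _×_; _,_; proj₁)
open import Data.Sum using (_⊎_; inj₁; inj₂; [_,_])
open import Data.List using (List)
open import Data.List.Relation.Unary.All using (All)
open import Data.List.Relation.Unary.Any using (Any)
open import Relation.Nullary using (¬_)
open import Relation.Binary.PropositionalEquality using (_≡_; _≢_)

-- Well-founded sets: Aczel's iterative sets (W-type), with extensional
-- equality given by bisimulation.

data V : Set₁ where
  sup : (I : Set) → (I → V) → V

infix 4 _≐_ _∈V_

_≐_ : V → V → Set
sup A f ≐ sup B g = (∀ a → ∃[ b ] (f a ≐ g b)) × (∀ b → ∃[ a ] (f a ≐ g b))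

_∈V_ : V → V → Set
x ∈V sup A f = ∃[ a ] (x ≐ f a)

_∪V_ : V → V → V
sup A f ∪V sup B g = sup (A ⊎ B) [ f , g ]

_∖V_ : V → V → V
sup A f ∖V t = sup (Σ A λ a → ¬ (f a ∈V t)) (λ p → f (proj₁ p))

pairV : V → V → V
pairV u v = sup Bool (λ { true → u ; false → v })

_⊗V_ : V → V → V
sup A f ⊗V sup B g = sup (A × B) (λ p → pairV (f (Data.Product.proj₁ p)) (g (Data.Product.proj₂ p)))

data Literal (n : ℕ) : Set where
  union  : Fin n → Fin n → Fin n → Literal n
  diff   : Fin n → Fin n → Fin n → Literal n
  otimes : Fin n → Fin n → Fin n → Literal n
  neq    : Fin n → Fin n → Literal n

Conjunction : ℕ → Set
Conjunction n = List (Literal n)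

OccursIn : ∀ {n} → Fin n → Literal n → Set
OccursIn v (union x y z)  = v ≡ x ⊎ v ≡ y ⊎ v ≡ z
OccursIn v (diff x y z)   = v ≡ x ⊎ v ≡ y ⊎ v ≡ z
OccursIn v (otimes x y z) = v ≡ x ⊎ v ≡ y ⊎ v ≡ z
OccursIn v (neq x y)      = v ≡ x ⊎ v ≡ y

InvolvesAll : ∀ {n} → Conjunction n → Set
InvolvesAll {n} Φ = ∀ (v : Fin n) → Any (OccursIn v) Φ

SatLit : ∀ {n} → (Fin n → V) → Literal n → Set
SatLit M (union x y z)  = M x ≐ (M y ∪V M z)
SatLit M (diff x y z)   = M x ≐ (M y ∖V M z)
SatLit M (otimes x y z) = M x ≐ (M y ⊗V M z)
SatLit M (neq x y)      = ¬ (M x ≐ M y)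

Models : ∀ {n} → (Fin n → V) → Conjunction n → Set
Models M Φ = All (SatLit M) Φ

Satisfiable : ∀ {n} → Conjunction n → Set₁
Satisfiable {n} Φ = ∃[ M ] Models {n} M Φ

-- ⊗-graphs with places Fin p.  The node {u , w} (u = w allowed, giving
-- the singleton node {u}) has target set T u w; T must be symmetric
-- since nodes are unordered.

record OGraph : Set where
  field
    size : ℕ
    T    : Fin size → Fin size → Subset size
    T-sym : ∀ u w → T u w ≡ T w u

module _ (G : OGraph) where
  open OGraph G

  data AccessiblePlace : Fin size → Set where
    source : ∀ q → (∀ u w → ¬ (q S.∈ T u w)) → AccessiblePlace q
    fire   : ∀ u w q → AccessiblePlace u → AccessiblePlace w →
             q S.∈ T u w → AccessiblePlace q

  Accessible : Set
  Accessible = ∀ q → AccessiblePlace q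

  NodeIn : Subset size → Subset size → Fin size → Fin size → Set
  NodeIn X Y u w = (u S.∈ X × w S.∈ Y) ⊎ (w S.∈ X × u S.∈ Y)

  FulLit : ∀ {n} → (Fin n → Subset size) → Literal n → Set
  FulLit F (union x y z)  = F x ≡ F y S.∪ F z
  FulLit F (diff x y z)   = F x ≡ F y S.─ F z
  FulLit F (neq x y)      = F x ≢ F y
  FulLit F (otimes x y z) =
      (∀ u w → u S.∈ F y → w S.∈ F z → Nonempty (T u w) × T u w ⊆ F x)
    × (∀ q → q S.∈ F x → ∃[ u ] ∃[ w ] (u S.∈ F y × w S.∈ F z × q S.∈ T u w))
    × (∀ u w q → ¬ NodeIn (F y) (F z) u w → q S.∈ T u w → ¬ (q S.∈ F x))

  Fulfills : ∀ {n} → Conjunction n → Set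
  Fulfills {n} Φ = ∃[ F ] All (FulLit {n} F) Φ

-- A model M of Φ induces a ⊗-graph whose places are the nonempty Venn regions of
-- the sets Mx (there are at most 2ⁿ − 1 of them): a region r inside the left-hand
-- side of a ⊗-literal is a target of the node {u, w} whenever some pair {a, b} with
-- a in region u and b in region w lies in r. A set lying in such a region is itself
-- a pair of sets lying in regions, so ∈-induction makes every region that contains
-- a set accessible; the remaining regions are sources.
--
-- Conversely, an accessible graph fulfilling Φ via 𝔉 is realised by attaching
-- infinitely many sets to every place: fresh atoms to the source places, and to the
-- targets of a node the pairs of sets already attached to its places, the target
-- being read off the indices of the components so that every target is reached.
-- Distinct places receive disjoint families of sets, hence interpreting x as the
-- union of the families over 𝔉(x) turns the conditions on 𝔉 into the literals of Φ.
{-# OPTIONS --safe #-}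
module Submission where

open import Defs
open import Data.Nat using (ℕ; _≤_; _∸_; _^_)
open import Data.Product using (_×_; ∃-syntax)
open import Relation.Nullary using (Dec)
open import Function.Bundles using (_⇔_)

open import Level using (Lift; lift)
open import Function using (_∘_)
open import Function.Bundles using (mk⇔)
open import Data.Bool using (Bool; true; false)
open import Data.Empty using (⊥)
open import Data.Unit using (⊤; tt)
open import Data.Product using (Σ; _,_; proj₁; proj₂)
open import Data.Sum using (_⊎_; inj₁; inj₂; [_,_]′)
open import Data.Sum as Sum using ()
open import Data.Nat using (zero; suc; _+_; _*_; _<_; NonZero; s≤s; z≤n)
open import Data.Nat.Properties using (+-comm; +-identityʳ; +-cancelˡ-≡; m≤n⇒m<n∨m≡n; <-cmp; ≤-reflexive)
open import Data.Nat.DivMod using (_mod_; _/_; _%_; [m+kn]%n≡m%n; m<n⇒m%n≡m; +-distrib-/-∣ʳ; m<n⇒m/n≡0; m*n/n≡m)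
open import Data.Nat.Divisibility using (divides-refl)
open import Data.Fin as Fin using (Fin; toℕ; splitAt; _↑ˡ_; _↑ʳ_; combine; remQuot)
open import Data.Fin.Properties using (toℕ-injective; toℕ<n; toℕ-fromℕ<; splitAt-↑ˡ; splitAt-↑ʳ; remQuot-combine; nonZeroIndex)
open import Data.Fin.Subset using (Subset; inside; outside; _∈_; _∪_; _─_; _⊆_; Nonempty)
open import Data.Fin.Subset.Properties using (⊆-antisym; x∈p∪q⁻; x∈p∪q⁺; p⊆p∪q; q⊆p∪q; _∈?_; nonempty?)
open import Data.List.Relation.Unary.All as All using ()
open import Data.List.Membership.Propositional using () renaming (_∈_ to _∈ₗ_)
open import Data.Vec using ([]; _∷_; tabulate)
open import Data.Vec.Base using (here; there)
open import Data.Vec.Properties using (lookup∘tabulate; []=⇒lookup; lookup⇒[]=)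
open import Relation.Nullary using (¬_; yes; no; does; contradiction)
open import Relation.Nullary.Decidable using (dec-true; _×-dec_)
open import Relation.Binary using (tri<; tri≈; tri>)
open import Relation.Binary.PropositionalEquality using (_≡_; _≢_; refl; sym; trans; cong; cong₂; subst; module ≡-Reasoning)

open ≡-Reasoning

-- Extensional equality and the set operations on V

≐-refl : ∀ x → x ≐ x
≐-refl (sup A f) = (λ a → a , ≐-refl (f a)) , (λ a → a , ≐-refl (f a))

≐-reflexive : ∀ {x y} → x ≡ y → x ≐ y
≐-reflexive {x} refl = ≐-refl x

≐-sym : ∀ {x y} → x ≐ y → y ≐ x
≐-sym {sup A f} {sup B g} (p , q) =
  (λ b → proj₁ (q b) , ≐-sym (proj₂ (q b))) ,
  (λ a → proj₁ (p a) , ≐-sym (proj₂ (p a)))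

≐-trans : ∀ {x y z} → x ≐ y → y ≐ z → x ≐ z
≐-trans {sup A f} {sup B g} {sup C h} (p , q) (p′ , q′) =
  (λ a → proj₁ (p′ (proj₁ (p a))) , ≐-trans (proj₂ (p a)) (proj₂ (p′ (proj₁ (p a))))) ,
  (λ c → proj₁ (q (proj₁ (q′ c))) , ≐-trans (proj₂ (q (proj₁ (q′ c)))) (proj₂ (q′ c)))

∈-resp-≐ˡ : ∀ {x y z} → x ≐ y → y ∈V z → x ∈V z
∈-resp-≐ˡ {z = sup C h} x≐y (c , y≐) = c , ≐-trans x≐y y≐

∈-resp-≐ʳ : ∀ {x y z} → x ∈V y → y ≐ z → x ∈V z
∈-resp-≐ʳ {y = sup B g} {sup C h} (b , x≐) (p , _) = proj₁ (p b) , ≐-trans x≐ (proj₂ (p b))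

∈-sup : ∀ {I} {f : I → V} i → f i ∈V sup I f
∈-sup {f = f} i = i , ≐-refl (f i)

≐-ext : ∀ {s t} → (∀ {c} → c ∈V s → c ∈V t) → (∀ {c} → c ∈V t → c ∈V s) → s ≐ t
≐-ext {sup A f} {sup B g} s⊆t t⊆s =
  (λ a → s⊆t (∈-sup a)) ,
  (λ b → proj₁ (t⊆s (∈-sup b)) , ≐-sym (proj₂ (t⊆s (∈-sup b))))

∉-self : ∀ x → ¬ x ∈V x
∉-self (sup A f) (a , fa≐) = ∉-self (f a) (∈-resp-≐ʳ (∈-sup a) fa≐)

∈-∪V⁺ : ∀ s t {c} → c ∈V s ⊎ c ∈V t → c ∈V s ∪V t
∈-∪V⁺ (sup A f) (sup B g) (inj₁ (a , e)) = inj₁ a , e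
∈-∪V⁺ (sup A f) (sup B g) (inj₂ (b , e)) = inj₂ b , e

∈-∪V⁻ : ∀ s t {c} → c ∈V s ∪V t → c ∈V s ⊎ c ∈V t
∈-∪V⁻ (sup A f) (sup B g) (inj₁ a , e) = inj₁ (a , e)
∈-∪V⁻ (sup A f) (sup B g) (inj₂ b , e) = inj₂ (b , e)

∈-∖V⁺ : ∀ s t {c} → c ∈V s → ¬ c ∈V t → c ∈V s ∖V t
∈-∖V⁺ (sup A f) t (a , e) c∉t = (a , λ fa∈t → c∉t (∈-resp-≐ˡ e fa∈t)) , e

∈-∖V⁻ : ∀ s t {c} → c ∈V s ∖V t → c ∈V s × ¬ c ∈V t
∈-∖V⁻ (sup A f) t ((a , fa∉t) , e) = (a , e) , λ c∈t → fa∉t (∈-resp-≐ˡ (≐-sym e) c∈t)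

pairV-comm : ∀ a b → pairV a b ≐ pairV b a
pairV-comm a b = (λ { true → false , ≐-refl a ; false → true , ≐-refl b })
               , (λ { true → false , ≐-refl b ; false → true , ≐-refl a })

pairV-cong : ∀ {a b c d} → a ≐ c → b ≐ d → pairV a b ≐ pairV c d
pairV-cong a≐c b≐d = (λ { true → true , a≐c ; false → false , b≐d })
                   , (λ { true → true , a≐c ; false → false , b≐d })

∈-pairVˡ : ∀ a b → a ∈V pairV a b
∈-pairVˡ a b = true , ≐-refl a

∈-pairVʳ : ∀ a b → b ∈V pairV a b
∈-pairVʳ a b = false , ≐-refl b

∈-pairV⁻ : ∀ {c a b} → c ∈V pairV a b → c ≐ a ⊎ c ≐ b
∈-pairV⁻ (true , e) = inj₁ e
∈-pairV⁻ (false , e) = inj₂ e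

pairV-injective : ∀ {a b c d} → pairV a b ≐ pairV c d → (a ≐ c × b ≐ d) ⊎ (a ≐ d × b ≐ c)
pairV-injective (p , q) with p true | p false | q true | q false
... | true , a≐c  | false , b≐d | _ | _ = inj₁ (a≐c , b≐d)
... | false , a≐d | true , b≐c  | _ | _ = inj₂ (a≐d , b≐c)
... | true , a≐c  | true , b≐c  | _ | false , b≐d = inj₁ (a≐c , b≐d)
... | true , a≐c  | true , b≐c  | _ | true , a≐d = inj₁ (a≐c , ≐-trans b≐c (≐-trans (≐-sym a≐c) a≐d))
... | false , a≐d | false , b≐d | true , a≐c | _ = inj₁ (a≐c , b≐d)
... | false , a≐d | false , b≐d | false , b≐c | _ = inj₂ (a≐d , b≐c)

∈-⊗V⁺ : ∀ s t {a b} → a ∈V s → b ∈V t → pairV a b ∈V s ⊗V t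
∈-⊗V⁺ (sup A f) (sup B g) (i , a≐) (j , b≐) = (i , j) , pairV-cong a≐ b≐

∈-⊗V⁻ : ∀ s t {c} → c ∈V s ⊗V t → ∃[ a ] ∃[ b ] (a ∈V s × b ∈V t × c ≐ pairV a b)
∈-⊗V⁻ (sup A f) (sup B g) ((i , j) , c≐) = f i , g j , ∈-sup i , ∈-sup j , c≐

≉pairV-of-three : ∀ {s a b c x y} → a ∈V s → b ∈V s → c ∈V s →
                  ¬ a ≐ b → ¬ a ≐ c → ¬ b ≐ c → ¬ s ≐ pairV x y
≉pairV-of-three a∈s b∈s c∈s a≉b a≉c b≉c s≐xy
  with ∈-pairV⁻ (∈-resp-≐ʳ a∈s s≐xy) | ∈-pairV⁻ (∈-resp-≐ʳ b∈s s≐xy) | ∈-pairV⁻ (∈-resp-≐ʳ c∈s s≐xy)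
... | inj₁ a≐ | inj₁ b≐ | _       = a≉b (≐-trans a≐ (≐-sym b≐))
... | inj₂ a≐ | inj₂ b≐ | _       = a≉b (≐-trans a≐ (≐-sym b≐))
... | inj₁ a≐ | _       | inj₁ c≐ = a≉c (≐-trans a≐ (≐-sym c≐))
... | inj₂ a≐ | _       | inj₂ c≐ = a≉c (≐-trans a≐ (≐-sym c≐))
... | _       | inj₁ b≐ | inj₁ c≐ = b≉c (≐-trans b≐ (≐-sym c≐))
... | _       | inj₂ b≐ | inj₂ c≐ = b≉c (≐-trans b≐ (≐-sym c≐))

-- Von Neumann numerals and atoms

num : ℕ → V
num zero    = sup ⊥ λ ()
num (suc n) = num n ∪V sup ⊤ (λ _ → num n)

num-∈ : ∀ {m n} → m < n → num m ∈V num n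
num-∈ {m} {suc n} (s≤s m≤n) with m≤n⇒m<n∨m≡n m≤n
... | inj₁ m<n  = ∈-∪V⁺ (num n) _ (inj₁ (num-∈ m<n))
... | inj₂ refl = ∈-∪V⁺ (num m) _ (inj₂ (tt , ≐-refl (num m)))

num-injective : ∀ {m n} → num m ≐ num n → m ≡ n
num-injective {m} {n} e with <-cmp m n
... | tri< m<n _ _ = contradiction (∈-resp-≐ʳ (num-∈ m<n) (≐-sym e)) (∉-self (num m))
... | tri≈ _ m≡n _ = m≡n
... | tri> _ _ n<m = contradiction (∈-resp-≐ʳ (num-∈ n<m) e) (∉-self (num n))

atom : ℕ → V
atom k = num (3 + k)

atom-injective : ∀ {k k′} → atom k ≐ atom k′ → k ≡ k′
atom-injective e = +-cancelˡ-≡ 3 _ _ (num-injective e)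

atom-≉-pairV : ∀ k {x y} → ¬ atom k ≐ pairV x y
atom-≉-pairV k = ≉pairV-of-three (num-∈ {0} {3 + k} (s≤s z≤n)) (num-∈ {1} {3 + k} (s≤s (s≤s z≤n)))
                                 (num-∈ {2} {3 + k} (s≤s (s≤s (s≤s z≤n))))
                                 (num-≉ {0} {1} λ ()) (num-≉ {0} {2} λ ()) (num-≉ {1} {2} λ ())
  where
  num-≉ : ∀ {m n} → m ≢ n → ¬ num m ≐ num n
  num-≉ m≢n e = m≢n (num-injective e)

-- Coding Fin s × ℕ into ℕ

encode : ∀ {s} → Fin s → ℕ → ℕ
encode {s} q k = toℕ q + k * s

module _ {s} .{{_ : NonZero s}} where

  encode-mod : ∀ (q : Fin s) k → encode q k mod s ≡ q
  encode-mod q k = toℕ-injective (begin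
    toℕ (encode q k mod s)  ≡⟨ toℕ-fromℕ< _ ⟩
    (toℕ q + k * s) % s     ≡⟨ [m+kn]%n≡m%n (toℕ q) k s ⟩
    toℕ q % s               ≡⟨ m<n⇒m%n≡m (toℕ<n q) ⟩
    toℕ q                   ∎)

  encode-div : ∀ (q : Fin s) k → encode q k / s ≡ k
  encode-div q k = begin
    (toℕ q + k * s) / s      ≡⟨ +-distrib-/-∣ʳ (toℕ q) (divides-refl k) ⟩
    toℕ q / s + k * s / s    ≡⟨ cong₂ _+_ (m<n⇒m/n≡0 (toℕ<n q)) (m*n/n≡m k s) ⟩
    k                        ∎

encode-injective : ∀ {s} (q q′ : Fin s) k k′ → encode q k ≡ encode q′ k′ → q ≡ q′ × k ≡ k′
encode-injective {suc s} q q′ k k′ e =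
  trans (sym (encode-mod q k)) (trans (cong (_mod suc s) e) (encode-mod q′ k′)) ,
  trans (sym (encode-div q k)) (trans (cong (_/ suc s) e) (encode-div q′ k′))

-- Subsets of Fin m

x∈p─q⁻ : ∀ {m} {x : Fin m} (p q : Subset m) → x ∈ p ─ q → x ∈ p × ¬ x ∈ q
x∈p─q⁻ (inside ∷ p) (outside ∷ q) here = here , λ ()
x∈p─q⁻ {x = Fin.zero} (outside ∷ p) (outside ∷ q) ()
x∈p─q⁻ {x = Fin.zero} (_ ∷ p)       (inside ∷ q)  ()
x∈p─q⁻ (b ∷ p) (c ∷ q) (there x∈) with x∈p─q⁻ p q x∈
... | x∈p , x∉q = there x∈p , λ { (there x∈q) → x∉q x∈q }

x∈p─q⁺ : ∀ {m} {x : Fin m} (p q : Subset m) → x ∈ p → ¬ x ∈ q → x ∈ p ─ q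
x∈p─q⁺ (inside ∷ p) (outside ∷ q) here x∉q = here
x∈p─q⁺ (inside ∷ p) (inside ∷ q)  here x∉q = contradiction here x∉q
x∈p─q⁺ (b ∷ p) (c ∷ q) (there x∈p) x∉q = there (x∈p─q⁺ p q x∈p (x∉q ∘ there))

choose : ∀ {m} → Subset m → Fin m → Fin m
choose S q with q ∈? S | nonempty? S
... | yes _ | _           = q
... | no _  | yes (r , _) = r
... | no _  | no _        = q

choose-∈ : ∀ {m} (S : Subset m) q → Nonempty S → choose S q ∈ S
choose-∈ S q ne with q ∈? S | nonempty? S
... | yes q∈S | _             = q∈S
... | no _    | yes (_ , r∈S) = r∈S
... | no _    | no empty      = contradiction ne empty

choose-self : ∀ {m} (S : Subset m) {q} → q ∈ S → choose S q ≡ q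
choose-self S {q} q∈S with q ∈? S | nonempty? S
... | yes _   | _ = refl
... | no q∉S  | _ = contradiction q∈S q∉S

bit : Fin 2 → Bool
bit Fin.zero    = outside
bit (Fin.suc _) = inside

bit-surjective : ∀ b → ∃[ c ] bit c ≡ b
bit-surjective outside = Fin.zero , refl
bit-surjective inside  = Fin.suc Fin.zero , refl

subsetAt : ∀ n → Fin (2 ^ n) → Subset n
subsetAt zero    _ = []
subsetAt (suc n) i = let (c , j) = remQuot {2} (2 ^ n) i in bit c ∷ subsetAt n j

subsetAt-surjective : ∀ n (X : Subset n) → ∃[ i ] subsetAt n i ≡ X
subsetAt-surjective zero    [] = Fin.zero , refl
subsetAt-surjective (suc n) (b ∷ X) with subsetAt-surjective n X | bit-surjective b
... | i , refl | c , refl =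
  combine c i , cong (λ r → bit (proj₁ r) ∷ subsetAt n (proj₂ r)) (remQuot-combine {2} c i)

#nonempty : ℕ → ℕ
#nonempty zero    = 0
#nonempty (suc n) = #nonempty n + 2 ^ n

nonemptySubsetAt : ∀ n → Fin (#nonempty n) → Subset n
nonemptySubsetAt (suc n) i =
  [ (outside ∷_) ∘ nonemptySubsetAt n , (inside ∷_) ∘ subsetAt n ]′ (splitAt (#nonempty n) i)

nonemptySubsetAt-↑ˡ : ∀ n i → nonemptySubsetAt (suc n) (i ↑ˡ 2 ^ n) ≡ outside ∷ nonemptySubsetAt n i
nonemptySubsetAt-↑ˡ n i rewrite splitAt-↑ˡ (#nonempty n) i (2 ^ n) = refl

nonemptySubsetAt-↑ʳ : ∀ n i → nonemptySubsetAt (suc n) (#nonempty n ↑ʳ i) ≡ inside ∷ subsetAt n i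
nonemptySubsetAt-↑ʳ n i rewrite splitAt-↑ʳ (#nonempty n) (2 ^ n) i = refl

nonemptySubsetAt-surjective : ∀ n (X : Subset n) → Nonempty X → ∃[ i ] nonemptySubsetAt n i ≡ X
nonemptySubsetAt-surjective (suc n) (inside ∷ X) _ with subsetAt-surjective n X
... | i , refl = #nonempty n ↑ʳ i , nonemptySubsetAt-↑ʳ n i
nonemptySubsetAt-surjective (suc n) (outside ∷ X) (Fin.suc x , there x∈X)
  with nonemptySubsetAt-surjective n X (x , x∈X)
... | i , refl = i ↑ˡ 2 ^ n , nonemptySubsetAt-↑ˡ n i

suc-#nonempty : ∀ n → suc (#nonempty n) ≡ 2 ^ n
suc-#nonempty zero    = refl
suc-#nonempty (suc n) =
  trans (cong (_+ 2 ^ n) (suc-#nonempty n)) (cong (2 ^ n +_) (sym (+-identityʳ (2 ^ n))))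

#nonempty≤ : ∀ n → #nonempty n ≤ 2 ^ n ∸ 1
#nonempty≤ n = ≤-reflexive (cong (_∸ 1) (suc-#nonempty n))

-- Realising an accessible ⊗-graph by sets

module Realisation (G : OGraph) where
  open OGraph G

  Source : Fin size → Set
  Source q = ∀ u w → ¬ q ∈ T u w

  -- A pair whose components carry the indices i and j is attached to the place and
  -- index decoded from i + j, which is symmetric as pairs are unordered; the
  -- argument u only certifies that size is nonzero.
  targetPlace : Fin size → Fin size → ℕ → Fin size
  targetPlace u w n = choose (T u w) (_mod_ n size {{nonZeroIndex u}})

  targetPlace-∈ : ∀ u w n → Nonempty (T u w) → targetPlace u w n ∈ T u w
  targetPlace-∈ u w n = choose-∈ (T u w) (_mod_ n size {{nonZeroIndex u}})

  targetIndex : Fin size → ℕ → ℕ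
  targetIndex u n = _/_ n size {{nonZeroIndex u}}

  targetPlace-comm : ∀ u w i j → targetPlace u w (i + j) ≡ targetPlace w u (j + i)
  targetPlace-comm u w i j =
    cong₂ choose (T-sym u w) (cong (λ n → _mod_ n size {{nonZeroIndex w}}) (+-comm i j))

  targetIndex-comm : ∀ u w i j → targetIndex u (i + j) ≡ targetIndex w (j + i)
  targetIndex-comm u w i j = cong (targetIndex w) (+-comm i j)

  data Element : Fin size → ℕ → Set where
    atomic : ∀ q k → Source q → Element q k
    pair   : ∀ {u w i j q k} → Element u i → Element w j → Nonempty (T u w) →
             targetPlace u w (i + j) ≡ q → targetIndex u (i + j) ≡ k → Element q k

  ⟦_⟧ : ∀ {q k} → Element q k → V
  ⟦ atomic q k _ ⟧   = atom (encode q k)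
  ⟦ pair a b _ _ _ ⟧ = pairV ⟦ a ⟧ ⟦ b ⟧

  ⟦⟧-injective : ∀ {q k q′ k′} (a : Element q k) (b : Element q′ k′) → ⟦ a ⟧ ≐ ⟦ b ⟧ →
                 q ≡ q′ × k ≡ k′
  ⟦⟧-injective (atomic q k _) (atomic q′ k′ _) e = encode-injective q q′ k k′ (atom-injective e)
  ⟦⟧-injective (atomic q k _) (pair _ _ _ _ _) e = contradiction e (atom-≉-pairV (encode q k))
  ⟦⟧-injective (pair _ _ _ _ _) (atomic q k _) e = contradiction (≐-sym e) (atom-≉-pairV (encode q k))
  ⟦⟧-injective (pair a₁ a₂ _ refl refl) (pair b₁ b₂ _ refl refl) e with pairV-injective e
  ... | inj₁ (e₁ , e₂) with ⟦⟧-injective a₁ b₁ e₁ | ⟦⟧-injective a₂ b₂ e₂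
  ...   | refl , refl | refl , refl = refl , refl
  ⟦⟧-injective (pair {u} {w} {i} {j} a₁ a₂ _ refl refl) (pair b₁ b₂ _ refl refl) e
      | inj₂ (e₁ , e₂) with ⟦⟧-injective a₁ b₂ e₁ | ⟦⟧-injective a₂ b₁ e₂
  ...   | refl , refl | refl , refl = targetPlace-comm u w i j , targetIndex-comm u w i j

  elementAt : ∀ {q} → AccessiblePlace G q → ∀ k → Element q k
  elementAt (source q src) k = atomic q k src
  elementAt (fire u w q acc-u acc-w q∈T) k =
    pair (elementAt acc-u (encode q k)) (elementAt acc-w 0) (q , q∈T) reaches-q reaches-k
    where
    reaches-q : targetPlace u w (encode q k + 0) ≡ q
    reaches-q = begin
      targetPlace u w (encode q k + 0)  ≡⟨ cong (targetPlace u w) (+-identityʳ _) ⟩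
      targetPlace u w (encode q k)      ≡⟨ cong (choose (T u w)) (encode-mod {{nonZeroIndex u}} q k) ⟩
      choose (T u w) q                  ≡⟨ choose-self (T u w) q∈T ⟩
      q                                 ∎
    reaches-k : targetIndex u (encode q k + 0) ≡ k
    reaches-k = trans (cong (targetIndex u) (+-identityʳ _)) (encode-div {{nonZeroIndex u}} q k)

  ⟦_⟧ₛ : Subset size → V
  ⟦ X ⟧ₛ = sup (Σ (Fin size) λ q → q ∈ X × Σ ℕ (Element q)) λ (_ , _ , _ , a) → ⟦ a ⟧

  ∈⟦⟧ₛ : ∀ {X q k} → q ∈ X → (a : Element q k) → ⟦ a ⟧ ∈V ⟦ X ⟧ₛ
  ∈⟦⟧ₛ q∈X a = ∈-sup (_ , q∈X , _ , a)

  ∈⟦⟧ₛ⇒∈ : ∀ {X q k} (a : Element q k) → ⟦ a ⟧ ∈V ⟦ X ⟧ₛ → q ∈ X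
  ∈⟦⟧ₛ⇒∈ a ((_ , q∈X , _ , b) , e) with ⟦⟧-injective a b e
  ... | refl , _ = q∈X

  ⟦⟧ₛ-mono : ∀ {X Y c} → X ⊆ Y → c ∈V ⟦ X ⟧ₛ → c ∈V ⟦ Y ⟧ₛ
  ⟦⟧ₛ-mono X⊆Y ((q , q∈X , k , a) , e) = (q , X⊆Y q∈X , k , a) , e

  ⟦⟧ₛ-∪ : ∀ X Y → ⟦ X ∪ Y ⟧ₛ ≐ ⟦ X ⟧ₛ ∪V ⟦ Y ⟧ₛ
  ⟦⟧ₛ-∪ X Y = ≐-ext to from
    where
    to : ∀ {c} → c ∈V ⟦ X ∪ Y ⟧ₛ → c ∈V ⟦ X ⟧ₛ ∪V ⟦ Y ⟧ₛ
    to ((q , q∈ , k , a) , e) =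
      ∈-∪V⁺ ⟦ X ⟧ₛ ⟦ Y ⟧ₛ (Sum.map (λ q∈X → (q , q∈X , k , a) , e) (λ q∈Y → (q , q∈Y , k , a) , e)
                                   (x∈p∪q⁻ X Y q∈))
    from : ∀ {c} → c ∈V ⟦ X ⟧ₛ ∪V ⟦ Y ⟧ₛ → c ∈V ⟦ X ∪ Y ⟧ₛ
    from c∈ = [ ⟦⟧ₛ-mono (p⊆p∪q Y) , ⟦⟧ₛ-mono (q⊆p∪q X Y) ]′ (∈-∪V⁻ ⟦ X ⟧ₛ ⟦ Y ⟧ₛ c∈)

  ⟦⟧ₛ-─ : ∀ X Y → ⟦ X ─ Y ⟧ₛ ≐ ⟦ X ⟧ₛ ∖V ⟦ Y ⟧ₛ
  ⟦⟧ₛ-─ X Y = ≐-ext to from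
    where
    to : ∀ {c} → c ∈V ⟦ X ─ Y ⟧ₛ → c ∈V ⟦ X ⟧ₛ ∖V ⟦ Y ⟧ₛ
    to ((q , q∈ , k , a) , e) =
      let (q∈X , q∉Y) = x∈p─q⁻ X Y q∈ in
      ∈-∖V⁺ ⟦ X ⟧ₛ ⟦ Y ⟧ₛ ((q , q∈X , k , a) , e)
            (λ c∈Y → q∉Y (∈⟦⟧ₛ⇒∈ a (∈-resp-≐ˡ (≐-sym e) c∈Y)))
    from : ∀ {c} → c ∈V ⟦ X ⟧ₛ ∖V ⟦ Y ⟧ₛ → c ∈V ⟦ X ─ Y ⟧ₛ
    from c∈ with ∈-∖V⁻ ⟦ X ⟧ₛ ⟦ Y ⟧ₛ c∈
    ... | ((q , q∈X , k , a) , e) , c∉Y =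
      (q , x∈p─q⁺ X Y q∈X (λ q∈Y → c∉Y ((q , q∈Y , k , a) , e)) , k , a) , e

  ⟦⟧ₛ-injective : Accessible G → ∀ {X Y} → ⟦ X ⟧ₛ ≐ ⟦ Y ⟧ₛ → X ≡ Y
  ⟦⟧ₛ-injective acc e = ⊆-antisym (included e) (included (≐-sym e))
    where
    included : ∀ {X Y} → ⟦ X ⟧ₛ ≐ ⟦ Y ⟧ₛ → X ⊆ Y
    included e {q} q∈X = let a = elementAt (acc q) 0 in ∈⟦⟧ₛ⇒∈ a (∈-resp-≐ʳ (∈⟦⟧ₛ q∈X a) e)

  ⟦⟧ₛ-⊗ : ∀ {n} (F : Fin n → Subset size) x y z → FulLit G F (otimes x y z) →
          ⟦ F x ⟧ₛ ≐ ⟦ F y ⟧ₛ ⊗V ⟦ F z ⟧ₛ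
  ⟦⟧ₛ-⊗ F x y z (targets⊆ , covered , unrelated) = ≐-ext to from
    where
    to : ∀ {c} → c ∈V ⟦ F x ⟧ₛ → c ∈V ⟦ F y ⟧ₛ ⊗V ⟦ F z ⟧ₛ
    to ((q , q∈ , _ , atomic _ _ src) , _) =
      let (u , w , _ , _ , q∈T) = covered q q∈ in contradiction q∈T (src u w)
    to ((q , q∈ , _ , pair {u} {w} {i} {j} a b ne refl _) , e)
      with (u ∈? F y ×-dec w ∈? F z) | (w ∈? F y ×-dec u ∈? F z)
    ... | yes (u∈ , w∈) | _ = ∈-resp-≐ˡ e (∈-⊗V⁺ ⟦ F y ⟧ₛ ⟦ F z ⟧ₛ (∈⟦⟧ₛ u∈ a) (∈⟦⟧ₛ w∈ b))
    ... | no _ | yes (w∈ , u∈) =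
      ∈-resp-≐ˡ (≐-trans e (pairV-comm ⟦ a ⟧ ⟦ b ⟧)) (∈-⊗V⁺ ⟦ F y ⟧ₛ ⟦ F z ⟧ₛ (∈⟦⟧ₛ w∈ b) (∈⟦⟧ₛ u∈ a))
    ... | no ¬uw | no ¬wu =
      contradiction q∈ (unrelated u w q [ ¬uw , ¬wu ]′ (targetPlace-∈ u w (i + j) ne))
    from : ∀ {c} → c ∈V ⟦ F y ⟧ₛ ⊗V ⟦ F z ⟧ₛ → c ∈V ⟦ F x ⟧ₛ
    from c∈ with ∈-⊗V⁻ ⟦ F y ⟧ₛ ⟦ F z ⟧ₛ c∈
    ... | _ , _ , ((u , u∈ , i , a) , a≐) , ((w , w∈ , j , b) , b≐) , c≐ =
      let (ne , T⊆) = targets⊆ u w u∈ w∈ in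
      (_ , T⊆ (targetPlace-∈ u w (i + j) ne) , _ , pair a b ne refl refl) ,
      ≐-trans c≐ (pairV-cong a≐ b≐)

  satLit : Accessible G → ∀ {n} (F : Fin n → Subset size) ℓ → FulLit G F ℓ → SatLit (⟦_⟧ₛ ∘ F) ℓ
  satLit _   F (union x y z)  Fx≡ = ≐-trans (≐-reflexive (cong ⟦_⟧ₛ Fx≡)) (⟦⟧ₛ-∪ (F y) (F z))
  satLit _   F (diff x y z)   Fx≡ = ≐-trans (≐-reflexive (cong ⟦_⟧ₛ Fx≡)) (⟦⟧ₛ-─ (F y) (F z))
  satLit _   F (otimes x y z) ful = ⟦⟧ₛ-⊗ F x y z ful
  satLit acc F (neq x y)      Fx≢ = Fx≢ ∘ ⟦⟧ₛ-injective acc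

  satisfiable : Accessible G → ∀ {n} {Φ : Conjunction n} → Fulfills G Φ → Satisfiable Φ
  satisfiable acc (F , ful) = ⟦_⟧ₛ ∘ F , All.map (λ {ℓ} → satLit acc F ℓ) ful

-- The ⊗-graph of the Venn regions of a model

module Classical (lem : (P : Set₁) → Dec P) where

  ⟨_⟩ : ∀ {m} → (Fin m → Set₁) → Subset m
  ⟨ P ⟩ = tabulate λ i → does (lem (P i))

  ∈⟨⟩⁻ : ∀ {m} {P : Fin m → Set₁} {i} → i ∈ ⟨ P ⟩ → P i
  ∈⟨⟩⁻ {P = P} {i} i∈ = witness (lem (P i)) (trans (sym (lookup∘tabulate _ i)) ([]=⇒lookup i∈))
    where
    witness : ∀ {A : Set₁} (d : Dec A) → does d ≡ true → A
    witness (yes a) _ = a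

  ∈⟨⟩⁺ : ∀ {m} {P : Fin m → Set₁} {i} → P i → i ∈ ⟨ P ⟩
  ∈⟨⟩⁺ {P = P} {i} p = lookup⇒[]= i _ (trans (lookup∘tabulate _ i) (dec-true (lem (P i)) p))

  ⟨⟩-cong : ∀ {m} {P Q : Fin m → Set₁} → (∀ {i} → P i → Q i) → (∀ {i} → Q i → P i) → ⟨ P ⟩ ≡ ⟨ Q ⟩
  ⟨⟩-cong P⇒Q Q⇒P = ⊆-antisym (∈⟨⟩⁺ ∘ P⇒Q ∘ ∈⟨⟩⁻) (∈⟨⟩⁺ ∘ Q⇒P ∘ ∈⟨⟩⁻)

module VennGraph (lem : (P : Set₁) → Dec P) {n} (Φ : Conjunction n) (M : Fin n → V) (M⊨Φ : Models M Φ)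
  where
  open Classical lem

  region : V → Subset n
  region a = ⟨ (λ x → Lift _ (a ∈V M x)) ⟩

  ∈-region⁺ : ∀ {a x} → a ∈V M x → x ∈ region a
  ∈-region⁺ a∈x = ∈⟨⟩⁺ (lift a∈x)

  ∈-region⁻ : ∀ {a x} → x ∈ region a → a ∈V M x
  ∈-region⁻ x∈ = Level.lower (∈⟨⟩⁻ x∈)

  ∈-resp-region : ∀ {a b x} → region a ≡ region b → b ∈V M x → a ∈V M x
  ∈-resp-region {x = x} a~b b∈x = ∈-region⁻ (subst (x ∈_) (sym a~b) (∈-region⁺ b∈x))

  region-resp-≐ : ∀ {a b} → a ≐ b → region a ≡ region b
  region-resp-≐ a≐b = ⟨⟩-cong (λ (lift a∈) → lift (∈-resp-≐ˡ (≐-sym a≐b) a∈))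
                              (λ (lift b∈) → lift (∈-resp-≐ˡ a≐b b∈))

  Place : Set
  Place = Fin (#nonempty n)

  regionAt : Place → Subset n
  regionAt = nonemptySubsetAt n

  placeOf : ∀ {a x} → a ∈V M x → ∃[ p ] region a ≡ regionAt p
  placeOf {a} a∈x =
    let (p , p~a) = nonemptySubsetAt-surjective n (region a) (_ , ∈-region⁺ a∈x) in p , sym p~a

  F : Fin n → Subset (#nonempty n)
  F x = ⟨ (λ p → ∃[ a ] (region a ≡ regionAt p × a ∈V M x)) ⟩

  ∈F⁻ : ∀ {p x} → p ∈ F x → ∃[ a ] (region a ≡ regionAt p × a ∈V M x)
  ∈F⁻ = ∈⟨⟩⁻

  ∈F⁺ : ∀ {a p x} → region a ≡ regionAt p → a ∈V M x → p ∈ F x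
  ∈F⁺ a∈p a∈x = ∈⟨⟩⁺ (_ , a∈p , a∈x)

  ∈F⇒∈ : ∀ {a p x} → region a ≡ regionAt p → p ∈ F x → a ∈V M x
  ∈F⇒∈ a∈p p∈F = let (b , b∈p , b∈x) = ∈F⁻ p∈F in ∈-resp-region (trans a∈p (sym b∈p)) b∈x

  F-mono : ∀ {x y} → (∀ {a} → a ∈V M x → a ∈V M y) → F x ⊆ F y
  F-mono Mx⊆My p∈Fx = let (a , a∈p , a∈x) = ∈F⁻ p∈Fx in ∈F⁺ a∈p (Mx⊆My a∈x)

  ProductPlace : Place → Set
  ProductPlace r = ∃[ x ] ∃[ y ] ∃[ z ] (otimes x y z ∈ₗ Φ × x ∈ regionAt r)

  productPlace : ∀ {x y z c r} → otimes x y z ∈ₗ Φ → region c ≡ regionAt r → c ∈V M x → ProductPlace r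
  productPlace {x} ⊗∈Φ c∈r c∈x = _ , _ , _ , ⊗∈Φ , subst (x ∈_) c∈r (∈-region⁺ c∈x)

  module _ {x y z} (⊗∈Φ : otimes x y z ∈ₗ Φ) where

    pairV-∈ : ∀ {a b} → a ∈V M y → b ∈V M z → pairV a b ∈V M x
    pairV-∈ a∈y b∈z = ∈-resp-≐ʳ (∈-⊗V⁺ (M y) (M z) a∈y b∈z) (≐-sym (All.lookup M⊨Φ ⊗∈Φ))

    ∈-⊗⁻ : ∀ {c} → c ∈V M x → ∃[ a ] ∃[ b ] (a ∈V M y × b ∈V M z × c ≐ pairV a b)
    ∈-⊗⁻ c∈x = ∈-⊗V⁻ (M y) (M z) (∈-resp-≐ʳ c∈x (All.lookup M⊨Φ ⊗∈Φ))

  Target : Place → Place → Place → Set₁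
  Target u w r = ProductPlace r ×
    ∃[ a ] ∃[ b ] (region a ≡ regionAt u × region b ≡ regionAt w × region (pairV a b) ≡ regionAt r)

  Target-comm : ∀ {u w r} → Target u w r → Target w u r
  Target-comm (prod , a , b , a∈u , b∈w , ab∈r) =
    prod , b , a , b∈w , a∈u , trans (region-resp-≐ (pairV-comm b a)) ab∈r

  ∈T⁻ : ∀ {u w r} → r ∈ ⟨ Target u w ⟩ → Target u w r
  ∈T⁻ = ∈⟨⟩⁻

  G : OGraph
  G = record { size = #nonempty n
             ; T = λ u w → ⟨ Target u w ⟩
             ; T-sym = λ u w → ⟨⟩-cong Target-comm Target-comm }

  region-accessible : ∀ c r → region c ≡ regionAt r → AccessiblePlace G r
  region-accessible (sup I f) r c∈r with lem (Lift _ (ProductPlace r))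
  ... | no ¬prod = source r λ u w r∈T → ¬prod (lift (proj₁ (∈T⁻ r∈T)))
  ... | yes (lift prod@(x , y , z , ⊗∈Φ , x∈r)) =
    let c∈x                        = ∈-region⁻ (subst (x ∈_) (sym c∈r) x∈r)
        (a , b , a∈y , b∈z , c≐ab) = ∈-⊗⁻ ⊗∈Φ c∈x
        (u , a∈u)                  = placeOf a∈y
        (w , b∈w)                  = placeOf b∈z
        (i , a≐fi)                 = ∈-resp-≐ʳ (∈-pairVˡ a b) (≐-sym c≐ab)
        (j , b≐fj)                 = ∈-resp-≐ʳ (∈-pairVʳ a b) (≐-sym c≐ab)
    in fire u w r (region-accessible (f i) u (trans (region-resp-≐ (≐-sym a≐fi)) a∈u))
                  (region-accessible (f j) w (trans (region-resp-≐ (≐-sym b≐fj)) b∈w))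
                  (∈⟨⟩⁺ (prod , a , b , a∈u , b∈w , trans (region-resp-≐ (≐-sym c≐ab)) c∈r))

  accessible : Accessible G
  accessible p with lem (∃[ a ] region a ≡ regionAt p)
  ... | yes (a , a∈p)  = region-accessible a p a∈p
  ... | no unrealised = source p λ u w p∈T →
    let (_ , a , b , _ , _ , ab∈p) = ∈T⁻ p∈T in unrealised (pairV a b , ab∈p)

  F-∪ : ∀ {x y z} → M x ≐ M y ∪V M z → F x ≡ F y ∪ F z
  F-∪ {x} {y} {z} sat = ⊆-antisym to from
    where
    to : F x ⊆ F y ∪ F z
    to p∈Fx = let (a , a∈p , a∈x) = ∈F⁻ p∈Fx in
      x∈p∪q⁺ (Sum.map (∈F⁺ a∈p) (∈F⁺ a∈p) (∈-∪V⁻ (M y) (M z) (∈-resp-≐ʳ a∈x sat)))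
    from : F y ∪ F z ⊆ F x
    from p∈ = [ F-mono (λ a∈y → ∈-resp-≐ʳ (∈-∪V⁺ (M y) (M z) (inj₁ a∈y)) (≐-sym sat))
              , F-mono (λ a∈z → ∈-resp-≐ʳ (∈-∪V⁺ (M y) (M z) (inj₂ a∈z)) (≐-sym sat))
              ]′ (x∈p∪q⁻ (F y) (F z) p∈)

  F-─ : ∀ {x y z} → M x ≐ M y ∖V M z → F x ≡ F y ─ F z
  F-─ {x} {y} {z} sat = ⊆-antisym to from
    where
    to : F x ⊆ F y ─ F z
    to p∈Fx = let (a , a∈p , a∈x) = ∈F⁻ p∈Fx
                  (a∈y , a∉z)     = ∈-∖V⁻ (M y) (M z) (∈-resp-≐ʳ a∈x sat) in
      x∈p─q⁺ (F y) (F z) (∈F⁺ a∈p a∈y) (a∉z ∘ ∈F⇒∈ a∈p)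
    from : F y ─ F z ⊆ F x
    from p∈ = let (p∈Fy , p∉Fz)   = x∈p─q⁻ (F y) (F z) p∈
                  (a , a∈p , a∈y) = ∈F⁻ p∈Fy in
      ∈F⁺ a∈p (∈-resp-≐ʳ (∈-∖V⁺ (M y) (M z) a∈y (p∉Fz ∘ ∈F⁺ a∈p)) (≐-sym sat))

  F-injective : ∀ {x y} → F x ≡ F y → M x ≐ M y
  F-injective Fx≡Fy = ≐-ext (included Fx≡Fy) (included (sym Fx≡Fy))
    where
    included : ∀ {x y c} → F x ≡ F y → c ∈V M x → c ∈V M y
    included Fx≡Fy c∈x = let (p , c∈p) = placeOf c∈x in
      ∈F⇒∈ c∈p (subst (p ∈_) Fx≡Fy (∈F⁺ c∈p c∈x))

  module _ {x y z} (⊗∈Φ : otimes x y z ∈ₗ Φ) where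

    F-⊗-targets : ∀ u w → u ∈ F y → w ∈ F z → Nonempty ⟨ Target u w ⟩ × ⟨ Target u w ⟩ ⊆ F x
    F-⊗-targets u w u∈Fy w∈Fz =
      let (a , a∈u , a∈y) = ∈F⁻ u∈Fy
          (b , b∈w , b∈z) = ∈F⁻ w∈Fz
          ab∈x            = pairV-∈ ⊗∈Φ a∈y b∈z
          (r , ab∈r)      = placeOf ab∈x
      in (r , ∈⟨⟩⁺ (productPlace ⊗∈Φ ab∈r ab∈x , a , b , a∈u , b∈w , ab∈r)) ,
         λ q∈T → let (_ , a′ , b′ , a′∈u , b′∈w , a′b′∈q) = ∈T⁻ q∈T in
                 ∈F⁺ a′b′∈q (pairV-∈ ⊗∈Φ (∈F⇒∈ a′∈u u∈Fy) (∈F⇒∈ b′∈w w∈Fz))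

    F-⊗-covered : ∀ q → q ∈ F x → ∃[ u ] ∃[ w ] (u ∈ F y × w ∈ F z × q ∈ ⟨ Target u w ⟩)
    F-⊗-covered q q∈Fx =
      let (c , c∈q , c∈x)            = ∈F⁻ q∈Fx
          (a , b , a∈y , b∈z , c≐ab) = ∈-⊗⁻ ⊗∈Φ c∈x
          (u , a∈u)                  = placeOf a∈y
          (w , b∈w)                  = placeOf b∈z
      in u , w , ∈F⁺ a∈u a∈y , ∈F⁺ b∈w b∈z ,
         ∈⟨⟩⁺ (productPlace ⊗∈Φ c∈q c∈x , a , b , a∈u , b∈w , trans (region-resp-≐ (≐-sym c≐ab)) c∈q)

    F-⊗-unrelated : ∀ u w q → ¬ NodeIn G (F y) (F z) u w → q ∈ ⟨ Target u w ⟩ → ¬ q ∈ F x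
    F-⊗-unrelated u w q ¬node q∈T q∈Fx with ∈T⁻ q∈T
    ... | _ , a , b , a∈u , b∈w , ab∈q with ∈-⊗⁻ ⊗∈Φ (∈F⇒∈ ab∈q q∈Fx)
    ... | _ , _ , a′∈y , b′∈z , ab≐ with pairV-injective ab≐
    ... | inj₁ (a≐ , b≐) = ¬node (inj₁ (∈F⁺ a∈u (∈-resp-≐ˡ a≐ a′∈y) , ∈F⁺ b∈w (∈-resp-≐ˡ b≐ b′∈z)))
    ... | inj₂ (a≐ , b≐) = ¬node (inj₂ (∈F⁺ b∈w (∈-resp-≐ˡ b≐ a′∈y) , ∈F⁺ a∈u (∈-resp-≐ˡ a≐ b′∈z)))

  fulLit : ∀ {ℓ} → ℓ ∈ₗ Φ → FulLit G F ℓ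
  fulLit {union x y z}  ℓ∈Φ = F-∪ (All.lookup M⊨Φ ℓ∈Φ)
  fulLit {diff x y z}   ℓ∈Φ = F-─ (All.lookup M⊨Φ ℓ∈Φ)
  fulLit {neq x y}      ℓ∈Φ = All.lookup M⊨Φ ℓ∈Φ ∘ F-injective
  fulLit {otimes x y z} ℓ∈Φ = F-⊗-targets ℓ∈Φ , F-⊗-covered ℓ∈Φ , F-⊗-unrelated ℓ∈Φ

  fulfils : Fulfills G Φ
  fulfils = F , All.tabulate fulLit

theorem1 : (lem : (P : Set₁) → Dec P) →
           ∀ (n : ℕ) (Φ : Conjunction n) → InvolvesAll Φ →
           Satisfiable Φ ⇔ (∃[ G ] ((OGraph.size G ≤ 2 ^ n ∸ 1) × Accessible G × Fulfills G Φ))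
theorem1 lem n Φ _ = mk⇔
  (λ (M , M⊨Φ) → let open VennGraph lem Φ M M⊨Φ in G , #nonempty≤ n , accessible , fulfils)
  (λ (G , _ , acc , G⊨Φ) → Realisation.satisfiable G acc G⊨Φ)
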